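{- Suppose $Act$ is finite and $|Act|\geq 2$. Then there is no finite set $\mathcal{E}$ of equations between monitors in $Mon_F$ that is sound for verdict equivalence (i.e., $\mathcal{E}\vdash m=n$ implies $m\simeq n$) and complete for verdict equivalence over open monitors (i.e., $m\simeq n$ implies $\mathcal{E}\vdash m=n$ for all $m,n\in Mon_F$).
   Context: Fix a set $Act$ of visible actions, a symbol $\tau\notin Act$, and a countably infinite set $Var$ of variables disjoint from $Act\cup\{\tau\}$. Monitors $Mon_F$: $m,n ::= v \mid a.m \mid m+n \mid x$ ($a\in Act$, $x\in Var$), verdicts $v ::= \mathit{end}\mid \mathit{yes}\mid \mathit{no}$. Closed monitors contain no variables; (closed) substitutions map variables to (closed) monitors. Transitions: for $\alpha\in Act\cup\{\tau\}$, $\xrightarrow{\alpha}$ is the least relation with $a.m\xrightarrow{a}m$; if $m\xrightarrow{\alpha}m'$ then $m+n\xrightarrow{\alpha}m'$ and $n+m\xrightarrow{\alpha}m'$; and $v\xrightarrow{\alpha}v$ for every verdict $v$ and every $\alpha$. Weak transitions: $m\xRightarrow{\varepsilon}m'$ iff $m(\xrightarrow{\tau})^*m'$; $m\xRightarrow{a}m'$ iff $m\xRightarrow{\varepsilon}m_1\xrightarrow{a}m_2\xRightarrow{\varepsilon}m'$; $m\xRightarrow{as'}m'$ ($s'\neq\varepsilon$) iff $m\xRightarrow{a}m_1\xRightarrow{s'}m'$. $L_a(m)=\{s\mid m\xRightarrow{s}\mathit{yes}\}$, $L_r(m)=\{s\mid m\xRightarrow{s}\mathit{no}\}$. Closed $m\simeq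 n$ iff $L_a(m)=L_a(n)$ and $L_r(m)=L_r(n)$; open $m\simeq n$ iff $\sigma(m)\simeq\sigma(n)$ for all closed substitutions $\sigma$. $\mathcal{E}\vdash m=n$: derivability by reflexivity, symmetry, transitivity, substitutivity (from $t=t'$ infer $\sigma(t)=\sigma(t')$) and congruence for $a.\_$ and $+$. -}

module Defs where

open import Data.Nat using (ℕ)
open import Data.Fin using (Fin)
open import Data.List using (List; []; _∷_)
open import Data.List.Membership.Propositional using (_∈_)
open import Data.Product using (_×_; _,_; ∃; ∃-syntax)
open import Function.Bundles using (_⇔_)
open import Relation.Binary.Construct.Closure.ReflexiveTransitive using (Star)

Var : Set
Var = ℕ

data Verdict : Set where
  end yes no : Verdict

module _ (k : ℕ) where

  Act : Set
  Act = Fin k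

  data Mon : Set where
    verd : Verdict → Mon
    _·_  : Act → Mon → Mon
    _⊕_  : Mon → Mon → Mon
    var  : Var → Mon

  data Label : Set where
    act : Act → Label
    τ   : Label

  data Step : Label → Mon → Mon → Set where
    pre   : ∀ {a m} → Step (act a) (a · m) m
    sumL  : ∀ {α m m' n} → Step α m m' → Step α (m ⊕ n) m'
    sumR  : ∀ {α m m' n} → Step α m m' → Step α (n ⊕ m) m'
    verdS : ∀ {α v} → Step α (verd v) (verd v)

  TauStar : Mon → Mon → Set
  TauStar = Star (Step τ)

  WeakAct : Act → Mon → Mon → Set
  WeakAct a m m' = ∃[ m₁ ] ∃[ m₂ ] (TauStar m m₁ × Step (act a) m₁ m₂ × TauStar m₂ m')

  Weak : List Act → Mon → Mon → Set
  Weak [] m m' = TauStar m m'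
  Weak (a ∷ []) m m' = WeakAct a m m'
  Weak (a ∷ s@(_ ∷ _)) m m' = ∃[ m₁ ] (WeakAct a m m₁ × Weak s m₁ m')

  InLa : Mon → List Act → Set
  InLa m s = Weak s m (verd yes)

  InLr : Mon → List Act → Set
  InLr m s = Weak s m (verd no)

  data Closed : Mon → Set where
    verdC : ∀ {v} → Closed (verd v)
    preC  : ∀ {a m} → Closed m → Closed (a · m)
    sumC  : ∀ {m n} → Closed m → Closed n → Closed (m ⊕ n)

  Subst : Set
  Subst = Var → Mon

  ClosedSubst : Subst → Set
  ClosedSubst σ = ∀ x → Closed (σ x)

  applySubst : Subst → Mon → Mon
  applySubst σ (verd v) = verd v
  applySubst σ (a · m)  = a · applySubst σ m
  applySubst σ (m ⊕ n)  = applySubst σ m ⊕ applySubst σ n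
  applySubst σ (var x)  = σ x

  _≃c_ : Mon → Mon → Set
  m ≃c n = (∀ s → InLa m s ⇔ InLa n s) × (∀ s → InLr m s ⇔ InLr n s)

  _≃_ : Mon → Mon → Set
  m ≃ n = ∀ σ → ClosedSubst σ → applySubst σ m ≃c applySubst σ n

  Equation : Set
  Equation = Mon × Mon

  data _⊢_≐_ (E : List Equation) : Mon → Mon → Set where
    ax    : ∀ {m n} → (m , n) ∈ E → E ⊢ m ≐ n
    refl≐ : ∀ {m} → E ⊢ m ≐ m
    sym≐  : ∀ {m n} → E ⊢ m ≐ n → E ⊢ n ≐ m
    trans≐ : ∀ {m n o} → E ⊢ m ≐ n → E ⊢ n ≐ o → E ⊢ m ≐ o
    subst≐ : ∀ {m n} (σ : Subst) → E ⊢ m ≐ n → E ⊢ applySubst σ m ≐ applySubst σ n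
    pre≐  : ∀ {m n} (a : Act) → E ⊢ m ≐ n → E ⊢ (a · m) ≐ (a · n)
    sum≐  : ∀ {m m' n n'} → E ⊢ m ≐ m' → E ⊢ n ≐ n' → E ⊢ (m ⊕ n) ≐ (m' ⊕ n')

  Sound : List Equation → Set
  Sound E = ∀ m n → E ⊢ m ≐ n → m ≃ n

  Complete : List Equation → Set
  Complete E = ∀ m n → m ≃ n → E ⊢ m ≐ n

module Submission where

-- Let ⟦ t ⟧ yes ρ be the traces accepted by t when each variable x accepts exactly the traces
-- ρ x. Closed substitutions only produce extension-closed ρ x; ExtClosedBelow L ρ asks this only
-- for traces shorter than L. If t ≃ u and depth u < L then ⟦ t ⟧ yes ρ ⊆ ⟦ u ⟧ yes ρ for all such
-- ρ: a trace of t is either variable-free, or reads a suffix s from an occurrence of a variable x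
-- at position w. Substituting for x the closed monitor accepting the extensions of s (s short), or
-- of s followed by a marker aᵐ d (s long), makes u accept the trace too, and the marker forces u to
-- read it through an occurrence of x at w (a variable-free run of u is too shallow to see the
-- marker). This validity is preserved by derivations, so if all equations of E have depth below L,
-- every equation derivable from E is valid in this sense. Yet x + a.x + a.H = x + a.H is sound
-- when H reaches both verdicts on every trace other than the aⁱ with i ≤ L (a.x only adds such
-- traces, and x accepts them by extension closure), while it fails for ρ x = {aᴸ}.

open import Defs
open import Data.Nat using (ℕ; zero; suc; _+_; _≤_; _<_; _⊔_; z≤n; s≤s; _≟_)
open import Data.Nat.Properties
  using (≤-refl; ≤-trans; <⇒≤; n≤1+n; m≤n+m; +-comm; +-cancelʳ-≤; m≤m⊔n; m≤n⊔m; <-≤-connex; <-irrefl; 1+n≢n; module ≤-Reasoning)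
open import Data.Fin using (Fin; zero; suc)
open import Data.List using (List; []; _∷_; _++_; [_]; _∷ʳ_; length; replicate; reverse)
open import Data.List.Properties
  using (++-assoc; ++-identityʳ; ++-cancelʳ; length-++; length-++-≤ʳ; length-replicate;
         ∷-injectiveˡ; ∷-injectiveʳ; reverse-++; unfold-reverse; reverse-injective; length-reverse)
open import Data.List.Membership.Propositional using (_∈_)
open import Data.List.Relation.Unary.Any using (here; there)
open import Data.Product using (Σ; ∃-syntax; _×_; _,_; proj₁; proj₂)
open import Data.Sum using (_⊎_; inj₁; inj₂)
open import Data.Empty using (⊥; ⊥-elim)
open import Function using (_∘_)
open import Function.Bundles using (_⇔_; mk⇔; Equivalence)
open import Relation.Nullary using (¬_)
import Relation.Nullary.Decidable as Dec
open import Relation.Binary.PropositionalEquality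
  using (_≡_; _≢_; refl; sym; cong; subst; module ≡-Reasoning)
open import Relation.Binary.Construct.Closure.ReflexiveTransitive using (ε; _◅_)

module _ {A : Set} where

  replicate-∷ʳ : ∀ n (x : A) → replicate n x ∷ʳ x ≡ x ∷ replicate n x
  replicate-∷ʳ zero    x = refl
  replicate-∷ʳ (suc n) x = cong (x ∷_) (replicate-∷ʳ n x)

  reverse-replicate : ∀ n (x : A) → reverse (replicate n x) ≡ replicate n x
  reverse-replicate zero    x = refl
  reverse-replicate (suc n) x = begin
    reverse (x ∷ replicate n x)  ≡⟨ unfold-reverse x (replicate n x) ⟩
    reverse (replicate n x) ∷ʳ x ≡⟨ cong (_∷ʳ x) (reverse-replicate n x) ⟩
    replicate n x ∷ʳ x           ≡⟨ replicate-∷ʳ n x ⟩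
    x ∷ replicate n x            ∎
    where open ≡-Reasoning

  ++-overlap-length : ∀ (w w' v r : List A) → w ++ v ≡ w' ++ (v ++ r) → length r ≤ length w
  ++-overlap-length w w' v r e = +-cancelʳ-≤ (length v) (length r) (length w) (begin
    length r + length v              ≡⟨ +-comm (length r) (length v) ⟩
    length v + length r              ≤⟨ m≤n+m _ (length w') ⟩
    length w' + (length v + length r) ≡⟨ cong (length w' +_) (length-++ v) ⟨
    length w' + length (v ++ r)      ≡⟨ length-++ w' ⟨
    length (w' ++ (v ++ r))          ≡⟨ cong length e ⟨
    length (w ++ v)                  ≡⟨ length-++ w ⟩
    length w + length v              ∎)
    where open ≤-Reasoning

  module Marker {a d : A} (a≢d : a ≢ d) where

    marker : ℕ → List A
    marker n = replicate n a ++ [ d ]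

    reverse-marker : ∀ p n → reverse (p ++ marker n) ≡ d ∷ replicate n a ++ reverse p
    reverse-marker p n = begin
      reverse (p ++ marker n)                          ≡⟨ reverse-++ p (marker n) ⟩
      reverse (marker n) ++ reverse p                  ≡⟨ cong (_++ reverse p) (reverse-++ (replicate n a) [ d ]) ⟩
      (d ∷ reverse (replicate n a)) ++ reverse p       ≡⟨ cong (λ q → d ∷ q ++ reverse p) (reverse-replicate n a) ⟩
      d ∷ replicate n a ++ reverse p                   ∎
      where open ≡-Reasoning

    no-d-among-a : ∀ n q {x y : List A} → length q < n → replicate n a ++ x ≢ q ++ d ∷ y
    no-d-among-a (suc n) []      _       e = a≢d (∷-injectiveˡ e)
    no-d-among-a (suc n) (_ ∷ q) (s≤s l) e = no-d-among-a n q l (∷-injectiveʳ e)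

    leading-d : ∀ n q {x y : List A} → length q ≤ n → d ∷ replicate n a ++ x ≡ q ++ d ∷ y → q ≡ []
    leading-d n []      l e = refl
    leading-d n (_ ∷ q) l e = ⊥-elim (no-d-among-a n q l (∷-injectiveʳ e))

    -- Reading both sides backwards, the d closing the copy inside r would have to sit among the a's.
    marker-rigid : ∀ w w' s r →
      w ++ (s ++ marker (length w)) ≡ w' ++ ((s ++ marker (length w)) ++ r) → w' ≡ w
    marker-rigid w w' s r e = sym (++-cancelʳ v w w' (begin
      w ++ v         ≡⟨ e ⟩
      w' ++ (v ++ r) ≡⟨ cong (λ q → w' ++ (v ++ q)) r≡[] ⟩
      w' ++ (v ++ []) ≡⟨ cong (w' ++_) (++-identityʳ v) ⟩
      w' ++ v        ∎))
      where
        open ≡-Reasoning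
        n = length w
        v = s ++ marker n

        reversed : d ∷ replicate n a ++ reverse (w ++ s) ≡ reverse r ++ d ∷ replicate n a ++ reverse (w' ++ s)
        reversed = begin
          d ∷ replicate n a ++ reverse (w ++ s)           ≡⟨ reverse-marker (w ++ s) n ⟨
          reverse ((w ++ s) ++ marker n)                   ≡⟨ cong reverse (++-assoc w s (marker n)) ⟩
          reverse (w ++ v)                                 ≡⟨ cong reverse e ⟩
          reverse (w' ++ (v ++ r))                         ≡⟨ cong reverse (++-assoc w' v r) ⟨
          reverse ((w' ++ v) ++ r)                         ≡⟨ reverse-++ (w' ++ v) r ⟩
          reverse r ++ reverse (w' ++ v)                   ≡⟨ cong (λ q → reverse r ++ reverse q) (++-assoc w' s (marker n)) ⟨
          reverse r ++ reverse ((w' ++ s) ++ marker n)     ≡⟨ cong (reverse r ++_) (reverse-marker (w' ++ s) n) ⟩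
          reverse r ++ d ∷ replicate n a ++ reverse (w' ++ s) ∎

        r≡[] : r ≡ []
        r≡[] = reverse-injective (leading-d n (reverse r)
          (subst (_≤ n) (sym (length-reverse r)) (++-overlap-length w w' v r e)) reversed)

module _ {k : ℕ} where

  Trace : Set
  Trace = List (Act k)

  Env : Set₁
  Env = Var → Trace → Set

  ∅ : Env
  ∅ _ _ = ⊥

  _⊆ₑ_ : Env → Env → Set
  ρ ⊆ₑ ρ' = ∀ {x w} → ρ x w → ρ' x w

  -- ⟦ m ⟧ yes ∅ and ⟦ m ⟧ no ∅ are the paper's L_a(m) and L_r(m) (weak⇔⟦⟧∅); ρ x gives the traces
  -- on which the variable x reaches the verdict.
  ⟦_⟧ : Mon k → Verdict → Env → Trace → Set
  ⟦ verd w ⟧ v ρ s      = w ≡ v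
  ⟦ b · t ⟧ v ρ []      = ⊥
  ⟦ b · t ⟧ v ρ (c ∷ s) = b ≡ c × ⟦ t ⟧ v ρ s
  ⟦ t ⊕ u ⟧ v ρ s       = ⟦ t ⟧ v ρ s ⊎ ⟦ u ⟧ v ρ s
  ⟦ var x ⟧ v ρ s       = ρ x s

  ⟦⟧-mono : ∀ t {v ρ ρ' s} → ρ ⊆ₑ ρ' → ⟦ t ⟧ v ρ s → ⟦ t ⟧ v ρ' s
  ⟦⟧-mono (verd _) _ h                  = h
  ⟦⟧-mono (b · t)  {s = _ ∷ _} f (e , h) = e , ⟦⟧-mono t f h
  ⟦⟧-mono (t ⊕ u) f (inj₁ h)            = inj₁ (⟦⟧-mono t f h)
  ⟦⟧-mono (t ⊕ u) f (inj₂ h)            = inj₂ (⟦⟧-mono u f h)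
  ⟦⟧-mono (var x) f h                   = f h

  ExtClosedBelow : ℕ → Env → Set
  ExtClosedBelow L ρ = ∀ x {w} → length w < L → ρ x w → ∀ r → ρ x (w ++ r)

  exactly : Trace → Env
  exactly w _ q = q ≡ w

  exactly-extClosedBelow : ∀ {w} → ExtClosedBelow (length w) (exactly w)
  exactly-extClosedBelow _ l refl _ = ⊥-elim (<-irrefl refl l)

  ⟦⟧-extClosedBelow : ∀ {L ρ} → ExtClosedBelow L ρ →
    ∀ t {v w} → length w < L → ⟦ t ⟧ v ρ w → ∀ r → ⟦ t ⟧ v ρ (w ++ r)
  ⟦⟧-extClosedBelow c (verd _) l h r                      = h
  ⟦⟧-extClosedBelow c (b · t) {w = _ ∷ w} l (e , h) r     = e , ⟦⟧-extClosedBelow c t (≤-trans (n≤1+n _) l) h r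
  ⟦⟧-extClosedBelow c (t ⊕ u) l (inj₁ h) r                = inj₁ (⟦⟧-extClosedBelow c t l h r)
  ⟦⟧-extClosedBelow c (t ⊕ u) l (inj₂ h) r                = inj₂ (⟦⟧-extClosedBelow c u l h r)
  ⟦⟧-extClosedBelow c (var x) l h r                       = c x l h r

  ⟦⟧∅-extClosed : ∀ t {v w} → ⟦ t ⟧ v ∅ w → ∀ r → ⟦ t ⟧ v ∅ (w ++ r)
  ⟦⟧∅-extClosed t {w = w} = ⟦⟧-extClosedBelow {L = suc (length w)} (λ _ _ ()) t ≤-refl

  ⟦_⟧ˢ : Subst k → Verdict → Env → Env
  ⟦ σ ⟧ˢ v ρ x = ⟦ σ x ⟧ v ρ

  ⟦applySubst⟧⁻ : ∀ σ t {v ρ s} → ⟦ applySubst k σ t ⟧ v ρ s → ⟦ t ⟧ v (⟦ σ ⟧ˢ v ρ) s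
  ⟦applySubst⟧⁻ σ (verd _) h                    = h
  ⟦applySubst⟧⁻ σ (b · t) {s = _ ∷ _} (e , h)   = e , ⟦applySubst⟧⁻ σ t h
  ⟦applySubst⟧⁻ σ (t ⊕ u) (inj₁ h)              = inj₁ (⟦applySubst⟧⁻ σ t h)
  ⟦applySubst⟧⁻ σ (t ⊕ u) (inj₂ h)              = inj₂ (⟦applySubst⟧⁻ σ u h)
  ⟦applySubst⟧⁻ σ (var x) h                     = h

  ⟦applySubst⟧⁺ : ∀ σ t {v ρ s} → ⟦ t ⟧ v (⟦ σ ⟧ˢ v ρ) s → ⟦ applySubst k σ t ⟧ v ρ s
  ⟦applySubst⟧⁺ σ (verd _) h                    = h
  ⟦applySubst⟧⁺ σ (b · t) {s = _ ∷ _} (e , h)   = e , ⟦applySubst⟧⁺ σ t h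
  ⟦applySubst⟧⁺ σ (t ⊕ u) (inj₁ h)              = inj₁ (⟦applySubst⟧⁺ σ t h)
  ⟦applySubst⟧⁺ σ (t ⊕ u) (inj₂ h)              = inj₂ (⟦applySubst⟧⁺ σ u h)
  ⟦applySubst⟧⁺ σ (var x) h                     = h

  ⟦⟧ˢ-extClosedBelow : ∀ {L ρ} σ {v} → ExtClosedBelow L ρ → ExtClosedBelow L (⟦ σ ⟧ˢ v ρ)
  ⟦⟧ˢ-extClosedBelow σ c x = ⟦⟧-extClosedBelow c (σ x)

  word : Label k → Trace
  word (act a) = [ a ]
  word τ       = []

  step⇒⟦⟧ : ∀ {α m m' v ρ s} → Step k α m m' → ⟦ m' ⟧ v ρ s → ⟦ m ⟧ v ρ (word α ++ s)
  step⇒⟦⟧ pre       h = refl , h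
  step⇒⟦⟧ (sumL st) h = inj₁ (step⇒⟦⟧ st h)
  step⇒⟦⟧ (sumR st) h = inj₂ (step⇒⟦⟧ st h)
  step⇒⟦⟧ verdS     h = h

  τ*⇒⟦⟧ : ∀ {m m' v ρ s} → TauStar k m m' → ⟦ m' ⟧ v ρ s → ⟦ m ⟧ v ρ s
  τ*⇒⟦⟧ ε          h = h
  τ*⇒⟦⟧ (st ◅ τs) h = step⇒⟦⟧ st (τ*⇒⟦⟧ τs h)

  weak-∷ : ∀ {a s m m₁ m'} → Step k (act a) m m₁ → Weak k s m₁ m' → Weak k (a ∷ s) m m'
  weak-∷ {s = []}    st τs = _ , _ , ε , st , τs
  weak-∷ {s = _ ∷ _} st w  = _ , (_ , _ , ε , st , ε) , w

  weak-uncons : ∀ {a s m m'} → Weak k (a ∷ s) m m' → ∃[ m₁ ] (WeakAct k a m m₁ × Weak k s m₁ m')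
  weak-uncons {s = []}    w = _ , w , ε
  weak-uncons {s = _ ∷ _} w = w

  weak⇒⟦⟧ : ∀ s {m m' v ρ r} → Weak k s m m' → ⟦ m' ⟧ v ρ r → ⟦ m ⟧ v ρ (s ++ r)
  weak⇒⟦⟧ []      τs h = τ*⇒⟦⟧ τs h
  weak⇒⟦⟧ (a ∷ s) w  h with weak-uncons w
  ... | _ , (_ , _ , τs₁ , st , τs₂) , w' = τ*⇒⟦⟧ τs₁ (step⇒⟦⟧ st (τ*⇒⟦⟧ τs₂ (weak⇒⟦⟧ s w' h)))

  ⟦⟧∅⇒τ : ∀ m {v} → ⟦ m ⟧ v ∅ [] → Step k τ m (verd v)
  ⟦⟧∅⇒τ (verd _) refl     = verdS
  ⟦⟧∅⇒τ (m ⊕ n) (inj₁ h) = sumL (⟦⟧∅⇒τ m h)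
  ⟦⟧∅⇒τ (m ⊕ n) (inj₂ h) = sumR (⟦⟧∅⇒τ n h)

  ⟦⟧∅⇒act : ∀ m {v a s} → ⟦ m ⟧ v ∅ (a ∷ s) → ∃[ m' ] (Step k (act a) m m' × ⟦ m' ⟧ v ∅ s)
  ⟦⟧∅⇒act (verd w) h       = verd w , verdS , h
  ⟦⟧∅⇒act (b · m) (refl , h) = m , pre , h
  ⟦⟧∅⇒act (m ⊕ n) (inj₁ h) with ⟦⟧∅⇒act m h
  ... | m' , st , h' = m' , sumL st , h'
  ⟦⟧∅⇒act (m ⊕ n) (inj₂ h) with ⟦⟧∅⇒act n h
  ... | m' , st , h' = m' , sumR st , h'

  ⟦⟧∅⇒weak : ∀ s {m v} → ⟦ m ⟧ v ∅ s → Weak k s m (verd v)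
  ⟦⟧∅⇒weak []      {m} h = ⟦⟧∅⇒τ m h ◅ ε
  ⟦⟧∅⇒weak (a ∷ s) {m} h with ⟦⟧∅⇒act m h
  ... | _ , st , h' = weak-∷ st (⟦⟧∅⇒weak s h')

  weak⇔⟦⟧∅ : ∀ s {m v} → Weak k s m (verd v) ⇔ ⟦ m ⟧ v ∅ s
  weak⇔⟦⟧∅ s {m} = mk⇔ (λ w → subst (⟦ m ⟧ _ ∅) (++-identityʳ s) (weak⇒⟦⟧ s w refl)) (⟦⟧∅⇒weak s)

  ⟦⟧⊆⇒weak⇒ : ∀ σ t u {v} → (∀ s → ⟦ t ⟧ v (⟦ σ ⟧ˢ v ∅) s → ⟦ u ⟧ v (⟦ σ ⟧ˢ v ∅) s) →
    ∀ s → Weak k s (applySubst k σ t) (verd v) → Weak k s (applySubst k σ u) (verd v)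
  ⟦⟧⊆⇒weak⇒ σ t u t⊆u s =
    Equivalence.from (weak⇔⟦⟧∅ s) ∘ ⟦applySubst⟧⁺ σ u ∘ t⊆u s ∘ ⟦applySubst⟧⁻ σ t ∘ Equivalence.to (weak⇔⟦⟧∅ s)

  ≃⇒⟦⟧⊆ : ∀ t u {σ s} → _≃_ k t u → ClosedSubst k σ →
    ⟦ t ⟧ yes (⟦ σ ⟧ˢ yes ∅) s → ⟦ u ⟧ yes (⟦ σ ⟧ˢ yes ∅) s
  ≃⇒⟦⟧⊆ t u {σ} {s} t≃u cl =
    ⟦applySubst⟧⁻ σ u ∘ Equivalence.to (weak⇔⟦⟧∅ s) ∘ Equivalence.to (proj₁ (t≃u σ cl) s)
      ∘ Equivalence.from (weak⇔⟦⟧∅ s) ∘ ⟦applySubst⟧⁺ σ t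

  depth : Mon k → ℕ
  depth (verd _) = 0
  depth (b · m)  = suc (depth m)
  depth (m ⊕ n)  = depth m ⊔ depth n
  depth (var _)  = 0

  ⟦⟧∅-truncate : ∀ t {v z r} → depth t ≤ length z → ⟦ t ⟧ v ∅ (z ++ r) → ⟦ t ⟧ v ∅ z
  ⟦⟧∅-truncate (verd _) l h                         = h
  ⟦⟧∅-truncate (b · t) {z = _ ∷ _} (s≤s l) (e , h)  = e , ⟦⟧∅-truncate t l h
  ⟦⟧∅-truncate (t ⊕ u) l (inj₁ h) = inj₁ (⟦⟧∅-truncate t (≤-trans (m≤m⊔n (depth t) (depth u)) l) h)
  ⟦⟧∅-truncate (t ⊕ u) l (inj₂ h) = inj₂ (⟦⟧∅-truncate u (≤-trans (m≤n⊔m (depth t) (depth u)) l) h)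

  data _∈ᵛ_at_ (x : Var) : Mon k → Trace → Set where
    here   : x ∈ᵛ var x at []
    prefix : ∀ {a m w} → x ∈ᵛ m at w → x ∈ᵛ a · m at (a ∷ w)
    left   : ∀ {m n w} → x ∈ᵛ m at w → x ∈ᵛ m ⊕ n at w
    right  : ∀ {m n w} → x ∈ᵛ n at w → x ∈ᵛ m ⊕ n at w

  data ViaVar (t : Mon k) (ρ : Env) (z : Trace) : Set where
    via : ∀ {x w s} → x ∈ᵛ t at w → ρ x s → z ≡ w ++ s → ViaVar t ρ z

  ⟦⟧-groundOrVia : ∀ t {v ρ z} → ⟦ t ⟧ v ρ z → ⟦ t ⟧ v ∅ z ⊎ ViaVar t ρ z
  ⟦⟧-groundOrVia (verd _) h = inj₁ h
  ⟦⟧-groundOrVia (b · t) {z = _ ∷ _} (refl , h) with ⟦⟧-groundOrVia t h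
  ... | inj₁ g               = inj₁ (refl , g)
  ... | inj₂ (via o hs refl) = inj₂ (via (prefix o) hs refl)
  ⟦⟧-groundOrVia (t ⊕ u) (inj₁ h) with ⟦⟧-groundOrVia t h
  ... | inj₁ g             = inj₁ (inj₁ g)
  ... | inj₂ (via o hs eq) = inj₂ (via (left o) hs eq)
  ⟦⟧-groundOrVia (t ⊕ u) (inj₂ h) with ⟦⟧-groundOrVia u h
  ... | inj₁ g             = inj₁ (inj₂ g)
  ... | inj₂ (via o hs eq) = inj₂ (via (right o) hs eq)
  ⟦⟧-groundOrVia (var x) h = inj₂ (via here h refl)

  ⟦⟧-via : ∀ {t x w v ρ s} → x ∈ᵛ t at w → ρ x s → ⟦ t ⟧ v ρ (w ++ s)
  ⟦⟧-via here       hs = hs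
  ⟦⟧-via (prefix o) hs = refl , ⟦⟧-via o hs
  ⟦⟧-via (left o)   hs = inj₁ (⟦⟧-via o hs)
  ⟦⟧-via (right o)  hs = inj₂ (⟦⟧-via o hs)

  chain : Trace → Mon k
  chain []      = verd yes
  chain (b ∷ w) = b · chain w

  chain-closed : ∀ w → Closed k (chain w)
  chain-closed []      = verdC
  chain-closed (_ ∷ w) = preC (chain-closed w)

  ⟦chain⟧ : ∀ w {ρ} → ⟦ chain w ⟧ yes ρ w
  ⟦chain⟧ []      = refl
  ⟦chain⟧ (_ ∷ w) = refl , ⟦chain⟧ w

  ⟦chain⟧⁻ : ∀ w {ρ q} → ⟦ chain w ⟧ yes ρ q → ∃[ r ] (q ≡ w ++ r)
  ⟦chain⟧⁻ []      {q = q} _        = q , refl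
  ⟦chain⟧⁻ (_ ∷ w) {q = _ ∷ _} (refl , h) with ⟦chain⟧⁻ w h
  ... | r , refl = r , refl

  probe : Var → Trace → Subst k
  probe x w y with y ≟ x
  ... | Dec.yes _ = chain w
  ... | Dec.no _  = verd end

  probe-closed : ∀ x w → ClosedSubst k (probe x w)
  probe-closed x w y with y ≟ x
  ... | Dec.yes _ = chain-closed w
  ... | Dec.no _  = verdC

  ⟦probe⟧ : ∀ x w {ρ} → ⟦ probe x w ⟧ˢ yes ρ x w
  ⟦probe⟧ x w with x ≟ x
  ... | Dec.yes _  = ⟦chain⟧ w
  ... | Dec.no x≢x = ⊥-elim (x≢x refl)

  ⟦probe⟧⁻ : ∀ x w y {ρ q} → ⟦ probe x w ⟧ˢ yes ρ y q → y ≡ x × ∃[ r ] (q ≡ w ++ r)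
  ⟦probe⟧⁻ x w y h with y ≟ x
  ... | Dec.yes y≡x = y≡x , ⟦chain⟧⁻ w h
  ⟦probe⟧⁻ x w y () | Dec.no _

  infix 4 _⊑[_]_ _≈[_]_

  record _⊑[_]_ (t : Mon k) (L : ℕ) (u : Mon k) : Set₁ where
    field ⊆-below : ∀ {ρ} → ExtClosedBelow L ρ → ∀ {z} → ⟦ t ⟧ yes ρ z → ⟦ u ⟧ yes ρ z
  open _⊑[_]_ public

  module _ (t u : Mon k) (t≃u : _≃_ k t u) where

    ≃-ground : ∀ {ρ z} → ⟦ t ⟧ yes ∅ z → ⟦ u ⟧ yes ρ z
    ≃-ground h = ⟦⟧-mono u (λ ()) (≃⇒⟦⟧⊆ t u {σ = λ _ → verd end} t≃u (λ _ → verdC) (⟦⟧-mono t (λ ()) h))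

    ≃-shortVia : ∀ {L ρ x w s} → ExtClosedBelow L ρ → length s < L → x ∈ᵛ t at w → ρ x s →
      ⟦ u ⟧ yes ρ (w ++ s)
    ≃-shortVia {ρ = ρ} {x} {s = s} c l o hs =
      ⟦⟧-mono u probe⊆ρ (≃⇒⟦⟧⊆ t u t≃u (probe-closed x s) (⟦⟧-via o (⟦probe⟧ x s)))
      where
        probe⊆ρ : ⟦ probe x s ⟧ˢ yes ∅ ⊆ₑ ρ
        probe⊆ρ {y} h with ⟦probe⟧⁻ x s y h
        ... | refl , r , refl = c x l hs r

    module _ {a d : Act k} (a≢d : a ≢ d) where
      open Marker a≢d

      ≃-longVia : ∀ {L ρ x w s} → depth u < L → L ≤ length s → x ∈ᵛ t at w → ρ x s →
        ⟦ u ⟧ yes ρ (w ++ s)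
      ≃-longVia {x = x} {w} {s} du Ls o hs
        with ⟦⟧-groundOrVia u (≃⇒⟦⟧⊆ t u t≃u (probe-closed x (s ++ marker (length w)))
                                       (⟦⟧-via o (⟦probe⟧ x (s ++ marker (length w)))))
      ... | inj₁ g = ⟦⟧-mono u (λ ()) (⟦⟧∅-truncate u (≤-trans (<⇒≤ du) (≤-trans Ls (length-++-≤ʳ s {w})))
                                        (subst (⟦ u ⟧ yes ∅) (sym (++-assoc w s _)) g))
      ... | inj₂ (via {x = y} {w'} o' hq e) with ⟦probe⟧⁻ x (s ++ marker (length w)) y hq
      ...   | refl , r , refl with marker-rigid w w' s r e
      ...     | refl = ⟦⟧-via o' hs

  ≃⇒⊑ : ∀ {a d : Act k} → a ≢ d → ∀ {t u L} → _≃_ k t u → depth u < L → t ⊑[ L ] u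
  ⊆-below (≃⇒⊑ a≢d {t} {u} {L} t≃u du) c h with ⟦⟧-groundOrVia t h
  ... | inj₁ g = ≃-ground t u t≃u g
  ... | inj₂ (via {s = s} o hs refl) with <-≤-connex (length s) L
  ...   | inj₁ short = ≃-shortVia t u t≃u c short o hs
  ...   | inj₂ long  = ≃-longVia t u t≃u a≢d du long o hs

  _≈[_]_ : Mon k → ℕ → Mon k → Set₁
  t ≈[ L ] u = t ⊑[ L ] u × u ⊑[ L ] t

  ⊑-refl : ∀ {t L} → t ⊑[ L ] t
  ⊆-below ⊑-refl c h = h

  ⊑-trans : ∀ {t u w L} → t ⊑[ L ] u → u ⊑[ L ] w → t ⊑[ L ] w
  ⊆-below (⊑-trans t⊑u u⊑w) c = ⊆-below u⊑w c ∘ ⊆-below t⊑u c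

  ⊑-subst : ∀ σ {t u L} → t ⊑[ L ] u → applySubst k σ t ⊑[ L ] applySubst k σ u
  ⊆-below (⊑-subst σ {t} {u} t⊑u) c =
    ⟦applySubst⟧⁺ σ u ∘ ⊆-below t⊑u (⟦⟧ˢ-extClosedBelow σ c) ∘ ⟦applySubst⟧⁻ σ t

  ⊑-pre : ∀ a {t u L} → t ⊑[ L ] u → a · t ⊑[ L ] a · u
  ⊆-below (⊑-pre a t⊑u) c {_ ∷ _} (e , h) = e , ⊆-below t⊑u c h

  ⊑-sum : ∀ {t t' u u' L} → t ⊑[ L ] t' → u ⊑[ L ] u' → t ⊕ u ⊑[ L ] t' ⊕ u'
  ⊆-below (⊑-sum t⊑t' u⊑u') c (inj₁ h) = inj₁ (⊆-below t⊑t' c h)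
  ⊆-below (⊑-sum t⊑t' u⊑u') c (inj₂ h) = inj₂ (⊆-below u⊑u' c h)

  ⊢⇒≈ : ∀ {E L} → (∀ {t u} → (t , u) ∈ E → t ≈[ L ] u) → ∀ {m n} → _⊢_≐_ k E m n → m ≈[ L ] n
  ⊢⇒≈ axioms (ax p)         = axioms p
  ⊢⇒≈ axioms refl≐          = ⊑-refl , ⊑-refl
  ⊢⇒≈ axioms (sym≐ d)       = proj₂ (⊢⇒≈ axioms d) , proj₁ (⊢⇒≈ axioms d)
  ⊢⇒≈ axioms (trans≐ d d')  =
    ⊑-trans (proj₁ (⊢⇒≈ axioms d)) (proj₁ (⊢⇒≈ axioms d')) ,
    ⊑-trans (proj₂ (⊢⇒≈ axioms d')) (proj₂ (⊢⇒≈ axioms d))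
  ⊢⇒≈ axioms (subst≐ σ d)   = ⊑-subst σ (proj₁ (⊢⇒≈ axioms d)) , ⊑-subst σ (proj₂ (⊢⇒≈ axioms d))
  ⊢⇒≈ axioms (pre≐ a d)     = ⊑-pre a (proj₁ (⊢⇒≈ axioms d)) , ⊑-pre a (proj₂ (⊢⇒≈ axioms d))
  ⊢⇒≈ axioms (sum≐ d d')    =
    ⊑-sum (proj₁ (⊢⇒≈ axioms d)) (proj₁ (⊢⇒≈ axioms d')) ,
    ⊑-sum (proj₂ (⊢⇒≈ axioms d)) (proj₂ (⊢⇒≈ axioms d'))

  depth-bound : (E : List (Equation k)) → ∃[ L ] (∀ {t u} → (t , u) ∈ E → depth t < L × depth u < L)
  depth-bound []            = 0 , λ ()
  depth-bound ((t , u) ∷ E) with depth-bound E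
  ... | L , bound = (dt ⊔ du) ⊔ L , λ
    { (here refl) → ≤-trans (m≤m⊔n dt du) (m≤m⊔n (dt ⊔ du) L) , ≤-trans (m≤n⊔m dt du) (m≤m⊔n (dt ⊔ du) L)
    ; (there p)   → ≤-trans (proj₁ (bound p)) (m≤n⊔m (dt ⊔ du) L) , ≤-trans (proj₂ (bound p)) (m≤n⊔m (dt ⊔ du) L)
    }
    where
      dt = suc (depth t)
      du = suc (depth u)

  ⨁ : ∀ n → (Fin n → Mon k) → Mon k
  ⨁ zero    f = verd end
  ⨁ (suc n) f = f zero ⊕ ⨁ n (f ∘ suc)

  ⨁-intro : ∀ {n} (f : Fin n → Mon k) i {v ρ s} → ⟦ f i ⟧ v ρ s → ⟦ ⨁ n f ⟧ v ρ s
  ⨁-intro f zero    h = inj₁ h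
  ⨁-intro f (suc i) h = inj₂ (⨁-intro (f ∘ suc) i h)

  ⨁-elim : ∀ n (f : Fin n → Mon k) {v ρ s} → v ≢ end → ⟦ ⨁ n f ⟧ v ρ s → ∃[ i ] ⟦ f i ⟧ v ρ s
  ⨁-elim zero    f v≢end refl     = ⊥-elim (v≢end refl)
  ⨁-elim (suc n) f v≢end (inj₁ h) = zero , h
  ⨁-elim (suc n) f v≢end (inj₂ h) with ⨁-elim n (f ∘ suc) v≢end h
  ... | i , h' = suc i , h'

  both : Mon k
  both = verd yes ⊕ verd no

≢end⇒yes⊎no : ∀ {v} → v ≢ end → yes ≡ v ⊎ no ≡ v
≢end⇒yes⊎no {yes} _     = inj₁ refl
≢end⇒yes⊎no {no}  _     = inj₂ refl
≢end⇒yes⊎no {end} v≢end = ⊥-elim (v≢end refl)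

module _ {k : ℕ} where

  cover : ℕ → Mon (suc k)
  cover zero    = both
  cover (suc n) = (zero · cover n) ⊕ ⨁ k (λ j → suc j · both)

  cover-or-power : ∀ n s {v ρ} → v ≢ end → ⟦ cover n ⟧ v ρ s ⊎ zero ∷ s ≡ s ∷ʳ zero
  cover-or-power zero    s           v≢end = inj₁ (≢end⇒yes⊎no v≢end)
  cover-or-power (suc n) []          _     = inj₂ refl
  cover-or-power (suc n) (zero ∷ s)  v≢end with cover-or-power n s v≢end
  ... | inj₁ h = inj₁ (inj₁ (refl , h))
  ... | inj₂ e = inj₂ (cong (zero ∷_) e)
  cover-or-power (suc n) (suc j ∷ s) v≢end =
    inj₁ (inj₂ (⨁-intro (λ j → suc j · both) j (refl , ≢end⇒yes⊎no v≢end)))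

  cover-misses-powers : ∀ n i {ρ} → i < n → ¬ ⟦ cover n ⟧ yes ρ (replicate i zero)
  cover-misses-powers (suc n) zero    _       (inj₁ ())
  cover-misses-powers (suc n) (suc i) (s≤s l) (inj₁ (_ , h)) = cover-misses-powers n i l h
  cover-misses-powers (suc n) i       _       (inj₂ h) with ⨁-elim k (λ j → suc j · both) (λ ()) h
  cover-misses-powers (suc n) zero    _ (inj₂ h) | _ , ()
  cover-misses-powers (suc n) (suc i) _ (inj₂ h) | _ , () , _

  witnessˡ witnessʳ : ℕ → Mon (suc k)
  witnessˡ n = var 0 ⊕ ((zero · var 0) ⊕ (zero · cover n))
  witnessʳ n = var 0 ⊕ (zero · cover n)

  witness-⊆ : ∀ n ρ {v} → v ≢ end → (∀ {w} → ρ 0 w → ∀ r → ρ 0 (w ++ r)) →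
    ∀ s → ⟦ witnessˡ n ⟧ v ρ s → ⟦ witnessʳ n ⟧ v ρ s
  witness-⊆ n ρ _ _ _ (inj₁ h)        = inj₁ h
  witness-⊆ n ρ _ _ _ (inj₂ (inj₂ h)) = inj₂ h
  witness-⊆ n ρ v≢end ext (_ ∷ s) (inj₂ (inj₁ (refl , h))) with cover-or-power n s v≢end
  ... | inj₁ hc = inj₂ (refl , hc)
  ... | inj₂ e  = inj₁ (subst (ρ 0) (sym e) (ext h [ zero ]))

  witness-sound : ∀ n → _≃_ (suc k) (witnessˡ n) (witnessʳ n)
  witness-sound n σ _ = reaches yes (λ ()) , reaches no (λ ())
    where
      reaches : ∀ v → v ≢ end → ∀ s →
        Weak (suc k) s (applySubst (suc k) σ (witnessˡ n)) (verd v) ⇔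
        Weak (suc k) s (applySubst (suc k) σ (witnessʳ n)) (verd v)
      reaches v v≢end s = mk⇔
        (⟦⟧⊆⇒weak⇒ σ (witnessˡ n) (witnessʳ n) (witness-⊆ n (⟦ σ ⟧ˢ v ∅) v≢end (⟦⟧∅-extClosed (σ 0))) s)
        (⟦⟧⊆⇒weak⇒ σ (witnessʳ n) (witnessˡ n) (λ { _ (inj₁ h) → inj₁ h ; _ (inj₂ h) → inj₂ (inj₂ h) }) s)

  witness-fails : ∀ L → ¬ (witnessˡ (suc L) ⊑[ L ] witnessʳ (suc L))
  witness-fails L l⊑r = refute (⊆-below l⊑r exactly-zeroᴸ-ext (inj₂ (inj₁ (refl , refl))))
    where
      zeroᴸ : List (Fin (suc k))
      zeroᴸ = replicate L zero

      exactly-zeroᴸ-ext : ExtClosedBelow L (exactly zeroᴸ)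
      exactly-zeroᴸ-ext = subst (λ n → ExtClosedBelow n (exactly zeroᴸ)) (length-replicate L) exactly-extClosedBelow

      refute : ¬ ⟦ witnessʳ (suc L) ⟧ yes (exactly zeroᴸ) (zero ∷ zeroᴸ)
      refute (inj₁ e)      = 1+n≢n (cong length e)
      refute (inj₂ (_ , h)) = cover-misses-powers (suc L) L ≤-refl h

theorem10 : (k : ℕ) → 2 ≤ k →
    ¬ (Σ (List (Equation k)) (λ E → Sound k E × Complete k E))
theorem10 (suc (suc k)) (s≤s (s≤s z≤n)) (E , sound , complete) =
  witness-fails L (proj₁ (⊢⇒≈ axioms-hold (complete _ _ (witness-sound (suc L)))))
  where
    L = proj₁ (depth-bound E)

    axioms-hold : ∀ {t u} → (t , u) ∈ E → t ≈[ L ] u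
    axioms-hold p =
      ≃⇒⊑ {a = zero} {d = suc zero} (λ ()) (sound _ _ (ax p)) (proj₂ (proj₂ (depth-bound E) p)) ,
      ≃⇒⊑ {a = zero} {d = suc zero} (λ ()) (sound _ _ (sym≐ (ax p))) (proj₁ (proj₂ (depth-bound E) p))
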